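{- Let $P_0\succ P_1\succ\cdots\succ P_t$ be the chain of partitions induced by the ideal-load plateaus of $G$, and for each $i$ let $\lambda_i:=1/L_i$. Then $(P_0\succ\cdots\succ P_t)$ is a principal sequence of partitions with levels $A_i:=B_i$ and strictly increasing strengths $0<\lambda_1<\cdots<\lambda_t$; in particular, for every $i$, \[ |A_i|=\bigl(\kappa(P_i)-\kappa(P_{i-1})\bigr)\cdot\lambda_i . \] Moreover, each $\lambda_i$ equals the partition value $\Phi(H)$ of the induced subgraphs $H$ that are first split at level $i$ in the ideal-load recursion.
   Context: $G=(V,E)$ is a simple undirected graph. For a partition $P$ of a vertex set, $\kappa(P)$ is its number of parts and $E(H/P)$ is the set of edges of $H$ whose endpoints lie in different parts. For a graph $H$, $\Phi(H):=\min_P |E(H/P)|/(|P|-1)$ over partitions $P$ of $V(H)$ with at least two parts. Ideal relative loads $\ell^\star:E\to\mathbb{R}_{>0}$ are defined recursively: take a partition $P^\star$ of $V$ attaining $\Phi(G)$ (with each part inducing a connected subgraph), set $\ell^\star(e)=1/\Phi(G)$ for all $e\in E(G/P^\star)$, and recurse on each induced subgraph $G[S]$, $S\in P^\star$, to define $\ell^\star$ on edges internal to $S$; an induced subgraph $H$ arising in this recursion is "split at level $i$" when its crossing edges receive load $L_i$. Let $L_1>L_2>\cdots>L_t>0$ be the distinct values of $\ell^\star$, $B_i:=\{e\in E:\ell^\star(e)=L_i\}$, $A_{\le i}:=\bigcup_{q\le i}B_q$, $P_0:=\{V\}$, and $P_i$ the partition of $V$ into connected components of $G-A_{\le i}$.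 A principal sequence of partitions (PSP) is a chain $P_0\succ P_1\succ\cdots\succ P_t$ with strictly increasing strengths $0<\lambda_1<\cdots<\lambda_t$ such that $P_i$ is obtained from $P_{i-1}$ by deleting an edge set $A_i$ with $|A_i|=(\kappa(P_i)-\kappa(P_{i-1}))\lambda_i$. -}

module Defs where

open import Data.Bool using (Bool; true; false; _∧_; not; if_then_else_)
open import Data.Nat using (ℕ; zero; suc; _+_; _<ᵇ_)
open import Data.Fin using (Fin; toℕ)
open import Data.Fin.Properties renaming (_≟_ to _≟F_)
open import Data.Integer using (ℤ; +_; -[1+_])
open import Data.Rational using (ℚ; mkℚ; 0ℚ; _/_; 1/_; _≤_)
open import Data.Product using (Σ; ∃; _×_; _,_)
open import Data.Unit using (⊤)
open import Data.Vec.Functional using (foldr)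
open import Relation.Nullary using (¬_)
open import Relation.Nullary.Decidable using (⌊_⌋)
open import Relation.Binary.PropositionalEquality using (_≡_)

record Graph (n : ℕ) : Set where
  field
    adj    : Fin n → Fin n → Bool
    sym    : ∀ u v → adj u v ≡ adj v u
    irrefl : ∀ u → adj u u ≡ false
open Graph public

VSet : ℕ → Set
VSet n = Fin n → Bool

allV : ∀ {n} → VSet n
allV _ = true

sumF : ∀ {n} → (Fin n → ℕ) → ℕ
sumF f = foldr _+_ 0 f

b2n : Bool → ℕ
b2n true  = 1
b2n false = 0

count2 : ∀ {n} → (Fin n → Fin n → Bool) → ℕ
count2 P = sumF (λ u → sumF (λ v → b2n ((toℕ u <ᵇ toℕ v) ∧ P u v)))

countEdges : ∀ {n} → Graph n → (Fin n → Fin n → Bool) → ℕ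
countEdges G P = count2 (λ u v → adj G u v ∧ P u v)

_≡ᵇ_ : ∀ {k} → Fin k → Fin k → Bool
i ≡ᵇ j = ⌊ i ≟F j ⌋

-- Partitions of a vertex set S, represented by a labelling p : Fin n → Fin k
-- which is surjective from S; the parts are the nonempty fibres, so κ = k.
-- (Labels of vertices outside S are irrelevant.)

IsPartition : ∀ {n} → VSet n → (k : ℕ) → (Fin n → Fin k) → Set
IsPartition S k p = ∀ j → ∃ λ v → S v ≡ true × p v ≡ j

part : ∀ {n k} → VSet n → (Fin n → Fin k) → Fin k → VSet n
part S p j v = S v ∧ (p v ≡ᵇ j)

cross : ∀ {n k} → Graph n → VSet n → (Fin n → Fin k) → ℕ
cross G S p = countEdges G (λ u v → S u ∧ S v ∧ not (p u ≡ᵇ p v))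

-- |E(G[S]/P)| / (|P| - 1) for a partition with |P| = 2 + m parts
ratio : ∀ {n} → Graph n → VSet n → (m : ℕ) → (Fin n → Fin (suc (suc m))) → ℚ
ratio G S m p = (+ cross G S p) / suc m

IsPhi : ∀ {n} → Graph n → VSet n → ℚ → Set
IsPhi G S φ =
  (Σ ℕ λ m → Σ (Fin _ → Fin (suc (suc m))) λ p →
     IsPartition S (suc (suc m)) p × ratio G S m p ≡ φ)
  × (∀ m (p : Fin _ → Fin (suc (suc m))) →
       IsPartition S (suc (suc m)) p → φ ≤ ratio G S m p)

data Reach {n} (G : Graph n) (ok : Fin n → Fin n → Set) : Fin n → Fin n → Set where
  here : ∀ {u} → Reach G ok u u
  step : ∀ {u v w} → adj G u v ≡ true → ok u v → Reach G ok v w → Reach G ok u w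

Connected : ∀ {n} → Graph n → VSet n → Set
Connected G S = ∀ u v → S u ≡ true → S v ≡ true →
  Reach G (λ a b → S a ≡ true × S b ≡ true) u v

IsComponents : ∀ {n} → Graph n → (D : Fin n → Fin n → Set) →
               (k : ℕ) → (Fin n → Fin k) → Set
IsComponents G D k p =
  (∀ j → ∃ λ v → p v ≡ j)
  × (∀ u v → p u ≡ p v → Reach G (λ a b → ¬ D a b) u v)
  × (∀ u v → Reach G (λ a b → ¬ D a b) u v → p u ≡ p v)

-- Total reciprocal on ℚ (1/q for q ≠ 0; value 0 at 0, never used there).

recip : ℚ → ℚ
recip (mkℚ (+ zero) _ _)      = 0ℚ
recip q@(mkℚ (+ (suc _)) _ _) = 1/ q
recip q@(mkℚ -[1+ _ ] _ _)    = 1/ q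

-- A run of the ideal-load recursion on G[S]: at a node, a partition P*
-- of S into 2+m connected parts attaining Φ(G[S]) = φ is chosen, and the
-- recursion continues on each part.

data LoadTree {n} (G : Graph n) : VSet n → Set where
  leaf : ∀ {S} → (∀ u v → S u ≡ true → S v ≡ true → u ≡ v) → LoadTree G S
  node : ∀ {S} (φ : ℚ) → IsPhi G S φ →
         (m : ℕ) (p : Fin n → Fin (suc (suc m))) →
         IsPartition S (suc (suc m)) p →
         ratio G S m p ≡ φ →
         (∀ j → Connected G (part S p j)) →
         ((j : Fin (suc (suc m))) → LoadTree G (part S p j)) →
         LoadTree G S

-- the ideal relative load ℓ*(uv) produced by the run (meaningful on edges)
load : ∀ {n} {G : Graph n} {S} → LoadTree G S → Fin n → Fin n → ℚ
load (leaf _) u v = 0ℚ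
load (node φ _ m p _ _ _ ts) u v =
  if p u ≡ᵇ p v then load (ts (p u)) u v else recip φ

AllNodes : ∀ {n} {G : Graph n} {S} → (VSet n → ℚ → Set) → LoadTree G S → Set
AllNodes P (leaf _) = ⊤
AllNodes {S = S} P (node φ _ m p _ _ _ ts) = P S φ × (∀ j → AllNodes P (ts j))

{-# OPTIONS --safe #-}
module Submission where

-- Along every branch of the ideal-load recursion Φ weakly increases: refining the optimal
-- partition P* of H inside one of its parts gives a partition of H, and minimality of Φ(H) is
-- then a mediant inequality.  So the loads 1/Φ weakly decrease downwards, and deleting the edges
-- of load > ℓ (resp. ≥ ℓ) leaves as components exactly the pieces cut out by the splits of level
-- > ℓ (resp. ≥ ℓ).  Going from > ℓ to ≥ ℓ performs precisely the splits H ↦ P*_H at level ℓ; each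
-- adds κ(P*_H) − 1 components and |E(H/P*_H)| = (κ(P*_H) − 1) Φ(H) edges of load ℓ, where
-- Φ(H) = 1/ℓ.  Summing over these H gives |B_i| = (κ(P_i) − κ(P_{i−1})) λ_i.

open import Defs renaming (sym to adj-sym)
open import Data.Bool using (Bool; true; false; _∧_; not; if_then_else_)
open import Data.Bool.Properties using (T-≡; ∧-zeroʳ)
open import Data.Empty using (⊥-elim)
open import Data.Fin as Fin using (Fin; toℕ; punchIn; punchOut; _↑ˡ_; _↑ʳ_; splitAt)
  renaming (_<_ to _<F_; _≤_ to _≤F_)
import Data.Fin.Properties as Fin
open import Data.Integer as ℤ using (+_; +[1+_]; -[1+_])
import Data.Integer.Properties as ℤ
open import Data.Nat as ℕ using (ℕ; zero; suc; _+_; _∸_; _<ᵇ_; z≤n; s≤s)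
  renaming (_<_ to _<ℕ_; _≤_ to _≤ℕ_)
open import Data.Nat.Coprimality using (Coprime)
import Data.Nat.Properties as ℕ
open import Algebra.Properties.Semiring.Sum ℕ.+-*-semiring
  using (sum; sum-cong-≗; ∑-distrib-+; ∑-comm; sum-remove; *-distribʳ-sum)
open import Data.Product using (∃; ∃₂; _×_; _,_; proj₁; proj₂)
open import Data.Rational using (ℚ; mkℚ; 0ℚ; _<_; _≤_; _*_; _/_; *<*; *≤*; toℚᵘ)
open import Data.Rational.Properties
import Data.Rational.Unnormalised as ℚᵘ
import Data.Rational.Unnormalised.Properties as ℚᵘ
open import Data.Sum using (inj₁; inj₂)
open import Data.Unit using (tt)
open import Function using (_∘_; _⇔_; Equivalence; mk⇔)
open import Relation.Binary using (Tri; tri<; tri≈; tri>)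
open import Relation.Binary.PropositionalEquality
open import Relation.Nullary using (Dec; yes; no; ¬_)
open import Relation.Nullary.Decidable using (⌊_⌋; dec-true; dec-false; does-⇔; isYes≗does)
open import Relation.Unary using (Decidable)

-- Rationals

data Pos : ℚ → Set where
  pos : ∀ a b .(c : Coprime (suc a) (suc b)) → Pos (mkℚ +[1+ a ] b c)

pos-view : ∀ {x} → 0ℚ < x → Pos x
pos-view {mkℚ +[1+ _ ] _ _} _ = pos _ _ _
pos-view {mkℚ (+ 0) _ _} (*<* (ℤ.+<+ ()))
pos-view {mkℚ -[1+ _ ] _ _} (*<* ())

recip-pos : ∀ {x} → 0ℚ < x → 0ℚ < recip x
recip-pos x>0 with pos-view x>0
... | pos _ _ _ = *<* (ℤ.+<+ (s≤s z≤n))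

recip-involutive : ∀ {x} → 0ℚ < x → recip (recip x) ≡ x
recip-involutive x>0 with pos-view x>0
... | pos _ _ _ = refl

recip-antimono-≤ : ∀ {x y} → 0ℚ < x → 0ℚ < y → x ≤ y → recip y ≤ recip x
recip-antimono-≤ x>0 y>0 x≤y with pos-view x>0 | pos-view y>0 | x≤y
... | pos a b _ | pos a′ b′ _ | *≤* le =
  *≤* (subst₂ ℤ._≤_ (ℤ.*-comm +[1+ a ] +[1+ b′ ]) (ℤ.*-comm +[1+ a′ ] +[1+ b ]) le)

recip-antimono-< : ∀ {x y} → 0ℚ < x → 0ℚ < y → x < y → recip y < recip x
recip-antimono-< x>0 y>0 x<y with pos-view x>0 | pos-view y>0 | x<y
... | pos a b _ | pos a′ b′ _ | *<* lt =
  *<* (subst₂ ℤ._<_ (ℤ.*-comm +[1+ a ] +[1+ b′ ]) (ℤ.*-comm +[1+ a′ ] +[1+ b ]) lt)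

frac : ℕ → ℕ → ℚ
frac a b = + a / suc b

frac≃ : ∀ a b → toℚᵘ (frac a b) ℚᵘ.≃ ℚᵘ.mkℚᵘ (+ a) b
frac≃ a b = toℚᵘ-fromℚᵘ (ℚᵘ.mkℚᵘ (+ a) b)

frac-mono-≤ : ∀ {a b c d} → a ℕ.* suc d ≤ℕ c ℕ.* suc b → frac a b ≤ frac c d
frac-mono-≤ {a} {b} {c} {d} le = toℚᵘ-cancel-≤
  (ℚᵘ.≤-respˡ-≃ (ℚᵘ.≃-sym (frac≃ a b)) (ℚᵘ.≤-respʳ-≃ (ℚᵘ.≃-sym (frac≃ c d))
    (ℚᵘ.*≤* (subst₂ ℤ._≤_ (ℤ.pos-* a (suc d)) (ℤ.pos-* c (suc b)) (ℤ.+≤+ le)))))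

frac-cancel-≤ : ∀ a b c d → frac a b ≤ frac c d → a ℕ.* suc d ≤ℕ c ℕ.* suc b
frac-cancel-≤ a b c d le
  with ℚᵘ.≤-respˡ-≃ (frac≃ a b) (ℚᵘ.≤-respʳ-≃ (frac≃ c d) (toℚᵘ-mono-≤ le))
... | ℚᵘ.*≤* le′ =
  ℤ.drop‿+≤+ (subst₂ ℤ._≤_ (sym (ℤ.pos-* a (suc d))) (sym (ℤ.pos-* c (suc b))) le′)

frac-injective : ∀ a b c d → frac a b ≡ frac c d → a ℕ.* suc d ≡ c ℕ.* suc b
frac-injective a b c d eq =
  ℕ.≤-antisym (frac-cancel-≤ a b c d (≤-reflexive eq)) (frac-cancel-≤ c d a b (≤-reflexive (sym eq)))

frac-pos : ∀ {a b} → 1 ≤ℕ a → 0ℚ < frac a b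
frac-pos {suc a} {b} _ = toℚᵘ-cancel-< (ℚᵘ.<-respʳ-≃ (ℚᵘ.≃-sym (frac≃ (suc a) b)) (ℚᵘ.*<* (ℤ.+<+ (s≤s z≤n))))

pos⇒frac : ∀ {x} → 0ℚ < x → ∃₂ λ c d → x ≡ frac c d
pos⇒frac x>0 with pos-view x>0
... | pos a b c = suc a , b , sym (fromℚᵘ-toℚᵘ (mkℚ +[1+ a ] b c))

frac-scale : ∀ e n c d → e ℕ.* suc d ≡ n ℕ.* c → frac e 0 ≡ frac n 0 * frac c d
frac-scale e n c d eq = toℚᵘ-injective
  (ℚᵘ.≃-trans (frac≃ e 0) (ℚᵘ.≃-trans (ℚᵘ.*≡* cross-mult) (ℚᵘ.≃-sym
    (ℚᵘ.≃-trans (toℚᵘ-homo-* (frac n 0) (frac c d)) (ℚᵘ.*-cong (frac≃ n 0) (frac≃ c d))))))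
  where
  open ≡-Reasoning
  cross-mult : + e ℤ.* + (1 ℕ.* suc d) ≡ (+ n ℤ.* + c) ℤ.* + 1
  cross-mult = begin
    + e ℤ.* + (1 ℕ.* suc d)  ≡⟨ sym (ℤ.pos-* e (1 ℕ.* suc d)) ⟩
    + (e ℕ.* (1 ℕ.* suc d))  ≡⟨ cong (λ k → + (e ℕ.* k)) (ℕ.*-identityˡ (suc d)) ⟩
    + (e ℕ.* suc d)          ≡⟨ cong +_ eq ⟩
    + (n ℕ.* c)              ≡⟨ ℤ.pos-* n c ⟩
    + n ℤ.* + c              ≡⟨ sym (ℤ.*-identityʳ (+ n ℤ.* + c)) ⟩
    (+ n ℤ.* + c) ℤ.* + 1    ∎

-- Finite sums and edge counts

sum-ones : ∀ n → sum {n} (λ _ → 1) ≡ n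
sum-ones zero    = refl
sum-ones (suc n) = cong suc (sum-ones n)

sum-zeros : ∀ n → sum {n} (λ _ → 0) ≡ 0
sum-zeros zero    = refl
sum-zeros (suc n) = sum-zeros n

sum-zero : ∀ {n} {f : Fin n → ℕ} → (∀ i → f i ≡ 0) → sum f ≡ 0
sum-zero {n} vanish = trans (sum-cong-≗ vanish) (sum-zeros n)

sum-≥ : ∀ {n} (f : Fin n → ℕ) i → f i ≤ℕ sum f
sum-≥ f Fin.zero    = ℕ.m≤m+n _ _
sum-≥ f (Fin.suc i) = ℕ.≤-trans (sum-≥ (λ i → f (Fin.suc i)) i) (ℕ.m≤n+m _ _)

sum-single : ∀ {n} (f : Fin n → ℕ) j → (∀ i → i ≢ j → f i ≡ 0) → sum f ≡ f j
sum-single {suc n} f j vanish = begin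
  sum f                              ≡⟨ sum-remove {i = j} f ⟩
  f j + sum (λ i → f (punchIn j i))  ≡⟨ cong (_+_ (f j)) (sum-zero (λ i → vanish _ (Fin.punchInᵢ≢i j i))) ⟩
  f j + 0                            ≡⟨ ℕ.+-identityʳ (f j) ⟩
  f j                                ∎
  where open ≡-Reasoning

⌊yes⌋ : ∀ {A : Set} (a? : Dec A) → A → ⌊ a? ⌋ ≡ true
⌊yes⌋ a? a = trans (isYes≗does a?) (dec-true a? a)

⌊no⌋ : ∀ {A : Set} (a? : Dec A) → ¬ A → ⌊ a? ⌋ ≡ false
⌊no⌋ a? ¬a = trans (isYes≗does a?) (dec-false a? ¬a)

if-true : ∀ {A : Set} {b} {x y : A} → b ≡ true → (if b then x else y) ≡ x
if-true refl = refl

if-false : ∀ {A : Set} {b} {x y : A} → b ≡ false → (if b then x else y) ≡ y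
if-false refl = refl

≡⇒≡ᵇ : ∀ {k} {i j : Fin k} → i ≡ j → (i ≡ᵇ j) ≡ true
≡⇒≡ᵇ {i = i} {j} = ⌊yes⌋ (i Fin.≟ j)

≢⇒≢ᵇ : ∀ {k} {i j : Fin k} → i ≢ j → (i ≡ᵇ j) ≡ false
≢⇒≢ᵇ {i = i} {j} = ⌊no⌋ (i Fin.≟ j)

≡ᵇ⇒≡ : ∀ {k} {i j : Fin k} → (i ≡ᵇ j) ≡ true → i ≡ j
≡ᵇ⇒≡ {i = i} {j} eq with i Fin.≟ j
... | yes i≡j = i≡j
≡ᵇ⇒≡ () | no _

≢ᵇ⇒≢ : ∀ {k} {i j : Fin k} → not (i ≡ᵇ j) ≡ true → i ≢ j
≢ᵇ⇒≢ i≢ᵇj i≡j with trans (cong not (sym (≡⇒≡ᵇ i≡j))) i≢ᵇj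
... | ()

≡ᵇ-cong : ∀ {k k′} {i j : Fin k} {i′ j′ : Fin k′} → (i ≡ j ⇔ i′ ≡ j′) → (i ≡ᵇ j) ≡ (i′ ≡ᵇ j′)
≡ᵇ-cong {i = i} {j} {i′} {j′} i≡j⇔i′≡j′ = trans (isYes≗does (i Fin.≟ j))
  (trans (does-⇔ i≡j⇔i′≡j′ (i Fin.≟ j) (i′ Fin.≟ j′)) (sym (isYes≗does (i′ Fin.≟ j′))))

∧-true-on : ∀ {a e} → (a ≡ true → e ≡ true) → (a ∧ e) ≡ a
∧-true-on {true}  e-on = e-on refl
∧-true-on {false} _    = refl

∧-false-on : ∀ {a e} → (a ≡ true → e ≡ false) → (a ∧ e) ≡ false
∧-false-on {true}  e-off = e-off refl
∧-false-on {false} _     = refl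

b2n-∧-+ : ∀ g {x y z} → b2n x ≡ b2n y + b2n z → b2n (g ∧ x) ≡ b2n (g ∧ y) + b2n (g ∧ z)
b2n-∧-+ true  eq = eq
b2n-∧-+ false eq = refl

b2n-∧-∑ : ∀ g {k x} {z : Fin k → Bool} →
          b2n x ≡ sum (λ j → b2n (z j)) → b2n (g ∧ x) ≡ sum (λ j → b2n (g ∧ z j))
b2n-∧-∑ true      eq = eq
b2n-∧-∑ false {k} eq = sym (sum-zeros k)

b2n-≡ᵇ-∑ : ∀ {k} (a b : Fin k) e → b2n ((a ≡ᵇ b) ∧ e) ≡ sum (λ j → b2n ((a ≡ᵇ j) ∧ (b ≡ᵇ j) ∧ e))
b2n-≡ᵇ-∑ a b e = sym (trans (sum-single _ a off-diagonal) on-diagonal)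
  where
  off-diagonal : ∀ j → j ≢ a → b2n ((a ≡ᵇ j) ∧ (b ≡ᵇ j) ∧ e) ≡ 0
  off-diagonal j j≢a rewrite ≢⇒≢ᵇ (j≢a ∘ sym) = refl
  on-diagonal : b2n ((a ≡ᵇ a) ∧ (b ≡ᵇ a) ∧ e) ≡ b2n ((a ≡ᵇ b) ∧ e)
  on-diagonal rewrite ≡⇒≡ᵇ (refl {x = a}) | ≡ᵇ-cong {i = b} {a} {a} {b} (mk⇔ sym sym) = refl

count2-cong : ∀ {n} {P Q : Fin n → Fin n → Bool} → (∀ u v → P u v ≡ Q u v) → count2 P ≡ count2 Q
count2-cong eq = sum-cong-≗ (λ u → sum-cong-≗ (λ v → cong (λ b → b2n (_ ∧ b)) (eq u v)))

count2-+ : ∀ {n} {P Q R : Fin n → Fin n → Bool} →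
           (∀ u v → b2n (P u v) ≡ b2n (Q u v) + b2n (R u v)) → count2 P ≡ count2 Q + count2 R
count2-+ {P = P} {Q} {R} eq = trans
  (sum-cong-≗ (λ u → trans (sum-cong-≗ (λ v → b2n-∧-+ (toℕ u <ᵇ toℕ v) (eq u v))) (∑-distrib-+ (Q′ u) (R′ u))))
  (∑-distrib-+ (sum ∘ Q′) (sum ∘ R′))
  where
  Q′ R′ : _ → _ → ℕ
  Q′ u v = b2n ((toℕ u <ᵇ toℕ v) ∧ Q u v)
  R′ u v = b2n ((toℕ u <ᵇ toℕ v) ∧ R u v)

count2-∑ : ∀ {n k} {P : Fin n → Fin n → Bool} {R : Fin k → Fin n → Fin n → Bool} →
           (∀ u v → b2n (P u v) ≡ sum (λ j → b2n (R j u v))) → count2 P ≡ sum (λ j → count2 (R j))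
count2-∑ {R = R} eq = trans
  (sum-cong-≗ (λ u → trans (sum-cong-≗ (λ v → b2n-∧-∑ (toℕ u <ᵇ toℕ v) {z = λ j → R j u v} (eq u v)))
                           (∑-comm (R′ u))))
  (∑-comm (λ u j → sum (λ v → R′ u v j)))
  where
  R′ : _ → _ → _ → ℕ
  R′ u v j = b2n ((toℕ u <ᵇ toℕ v) ∧ R j u v)

count2-pos-< : ∀ {n} (P : Fin n → Fin n → Bool) {u v} → toℕ u <ℕ toℕ v → P u v ≡ true → 1 ≤ℕ count2 P
count2-pos-< P {u} {v} u<v Puv = ℕ.≤-trans (ℕ.≤-reflexive (sym term≡1)) (ℕ.≤-trans (sum-≥ _ v) (sum-≥ _ u))
  where
  term≡1 : b2n ((toℕ u <ᵇ toℕ v) ∧ P u v) ≡ 1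
  term≡1 rewrite Puv | Equivalence.to T-≡ (ℕ.<⇒<ᵇ u<v) = refl

count2-pos : ∀ {n} (P : Fin n → Fin n → Bool) {u v} →
             P u v ≡ true → P v u ≡ true → u ≢ v → 1 ≤ℕ count2 P
count2-pos P {u} {v} Puv Pvu u≢v with ℕ.<-cmp (toℕ u) (toℕ v)
... | tri< u<v _ _ = count2-pos-< P u<v Puv
... | tri≈ _ u≡v _ = ⊥-elim (u≢v (Fin.toℕ-injective u≡v))
... | tri> _ _ v<u = count2-pos-< P v<u Pvu

count2-zero : ∀ {n} {P : Fin n → Fin n → Bool} → (∀ u v → P u v ≡ false) → count2 P ≡ 0
count2-zero {n} {P} none = trans (count2-cong none)
  (sum-zero {n} (λ u → sum-zero {n} (λ v → cong b2n (∧-zeroʳ (toℕ u <ᵇ toℕ v)))))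

edgesIn : ∀ {n} → Graph n → VSet n → (Fin n → Fin n → Bool) → ℕ
edgesIn G S Q = countEdges G (λ u v → S u ∧ S v ∧ Q u v)

b2n-split : ∀ c q → b2n q ≡ b2n (not c ∧ q) + b2n (c ∧ q)
b2n-split true  q = refl
b2n-split false q = sym (ℕ.+-identityʳ _)

b2n-split-label : ∀ s t {k} (x y : Fin k) q →
  b2n (s ∧ t ∧ ((x ≡ᵇ y) ∧ q)) ≡ sum (λ j → b2n ((s ∧ (x ≡ᵇ j)) ∧ (t ∧ (y ≡ᵇ j)) ∧ q))
b2n-split-label true  true  x y q = b2n-≡ᵇ-∑ x y q
b2n-split-label true  false x y q = sym (sum-zero (λ j → cong b2n (∧-zeroʳ (x ≡ᵇ j))))
b2n-split-label false t {k} x y q = sym (sum-zeros k)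

module _ {n} (G : Graph n) where

  edgesIn-cong : ∀ {S Q Q′} → (∀ u v → adj G u v ≡ true → S u ≡ true → S v ≡ true → Q u v ≡ Q′ u v) →
                 edgesIn G S Q ≡ edgesIn G S Q′
  edgesIn-cong {S} {Q} {Q′} eq = count2-cong pointwise
    where
    pointwise : ∀ u v → (adj G u v ∧ (S u ∧ S v ∧ Q u v)) ≡ (adj G u v ∧ (S u ∧ S v ∧ Q′ u v))
    pointwise u v with adj G u v in e | S u in su | S v in sv
    ... | true  | true  | true  = eq u v e su sv
    ... | true  | true  | false = refl
    ... | true  | false | _     = refl
    ... | false | _     | _     = refl

  edgesIn-none : ∀ {S Q} → (∀ u v → adj G u v ≡ true → S u ≡ true → S v ≡ true → Q u v ≡ false) →
                 edgesIn G S Q ≡ 0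
  edgesIn-none {S} {Q} none = trans (edgesIn-cong none) (count2-zero pointwise)
    where
    pointwise : ∀ u v → (adj G u v ∧ (S u ∧ S v ∧ false)) ≡ false
    pointwise u v rewrite ∧-zeroʳ (S v) | ∧-zeroʳ (S u) = ∧-zeroʳ (adj G u v)

  edgesIn-parts : ∀ {k} S Q (p : Fin n → Fin k) →
    edgesIn G S Q ≡ edgesIn G S (λ u v → not (p u ≡ᵇ p v) ∧ Q u v) + sum (λ j → edgesIn G (part S p j) Q)
  edgesIn-parts {k} S Q p = trans
    (count2-+ (λ u v → b2n-∧-+ (adj G u v) (b2n-∧-+ (S u) (b2n-∧-+ (S v) (b2n-split (p u ≡ᵇ p v) (Q u v))))))
    (cong (_+_ _) (count2-∑ {R = λ j u v → adj G u v ∧ inPart j u v} (λ u v →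
      b2n-∧-∑ (adj G u v) {z = λ j → inPart j u v} (b2n-split-label (S u) (S v) (p u) (p v) (Q u v)))))
    where
    inPart : Fin k → Fin n → Fin n → Bool
    inPart j u v = part S p j u ∧ part S p j v ∧ Q u v

-- Reachability and components

module _ {n} (G : Graph n) where

  adj⇒≢ : ∀ {u v} → adj G u v ≡ true → u ≢ v
  adj⇒≢ {u} e refl with trans (sym e) (irrefl G u)
  ... | ()

  countEdges-pos : ∀ {Q u v} → adj G u v ≡ true → Q u v ≡ true → Q v u ≡ true → 1 ≤ℕ countEdges G Q
  countEdges-pos {Q} {u} {v} e Quv Qvu =
    count2-pos _ (cong₂ _∧_ e Quv) (cong₂ _∧_ (trans (adj-sym G v u) e) Qvu) (adj⇒≢ e)

  Reach-map : ∀ {ok ok′ : Fin n → Fin n → Set} → (∀ {a b} → adj G a b ≡ true → ok a b → ok′ a b) →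
              ∀ {u v} → Reach G ok u v → Reach G ok′ u v
  Reach-map f here           = here
  Reach-map f (step e ok r) = step e (f e ok) (Reach-map f r)

  Reach-crosses : ∀ {ok k} (c : Fin n → Fin k) {u w} → Reach G ok u w → c u ≢ c w →
                  ∃₂ λ a b → adj G a b ≡ true × ok a b × c a ≢ c b
  Reach-crosses c here cu≢cw = ⊥-elim (cu≢cw refl)
  Reach-crosses c {u} (step {v = v} e ok r) cu≢cw with c u Fin.≟ c v
  ... | yes cu≡cv = Reach-crosses c r (cu≢cw ∘ trans cu≡cv)
  ... | no  cu≢cv = u , v , e , ok , cu≢cv

  IsComponents-cong : ∀ {D D′ k c} → (∀ {a b} → adj G a b ≡ true → D a b ⇔ D′ a b) →
                      IsComponents G D k c → IsComponents G D′ k c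
  IsComponents-cong D⇔D′ (onto , connected , closed) =
      onto
    , (λ u v cu≡cv → Reach-map (λ e ¬D → ¬D ∘ Equivalence.from (D⇔D′ e)) (connected u v cu≡cv))
    , (λ u v r → closed u v (Reach-map (λ e ¬D′ → ¬D′ ∘ Equivalence.to (D⇔D′ e)) r))

  IsComponents-edge : ∀ {D k c u v} → IsComponents G D k c → adj G u v ≡ true → ¬ D u v → c u ≡ c v
  IsComponents-edge (_ , _ , closed) e ¬D = closed _ _ (step e ¬D here)

  IsComponents-refine : ∀ {D D′ k k′ c c′} → (∀ {a b} → D a b → D′ a b) →
                        IsComponents G D k c → IsComponents G D′ k′ c′ → ∀ u v → c′ u ≡ c′ v → c u ≡ c v
  IsComponents-refine D⇒D′ (_ , _ , closed) (_ , connected′ , _) u v c′u≡c′v =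
    closed u v (Reach-map (λ _ ¬D′ → ¬D′ ∘ D⇒D′) (connected′ u v c′u≡c′v))

-- Partitions and the partition value Φ

module _ {n k} (S : VSet n) (p : Fin n → Fin k) where

  b2n-parts : ∀ v → b2n (S v) ≡ sum (λ j → b2n (part S p j v))
  b2n-parts v with S v
  ... | true  = sym (trans (sum-single _ (p v) (λ j j≢pv → cong b2n (≢⇒≢ᵇ (j≢pv ∘ sym))))
                          (cong b2n (≡⇒≡ᵇ refl)))
  ... | false = sym (sum-zeros k)

module _ {n k} (S : VSet n) (p : Fin n → Fin k) {j : Fin k} where

  part⇒ : ∀ {v} → part S p j v ≡ true → S v ≡ true × p v ≡ j
  part⇒ {v} inPart with S v
  ... | true = refl , ≡ᵇ⇒≡ inPart

  ⇒part : ∀ {v} → S v ≡ true → p v ≡ j → part S p j v ≡ true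
  ⇒part Sv pv≡j rewrite Sv = ≡⇒≡ᵇ pv≡j

part-nonempty : ∀ {n k} (S : VSet n) (p : Fin n → Fin k) → IsPartition S k p → ∀ j → ∃ λ v → part S p j v ≡ true
part-nonempty S p onto j = proj₁ (onto j) , ⇒part S p (proj₁ (proj₂ (onto j))) (proj₂ (proj₂ (onto j)))

↑ˡ≢↑ʳ : ∀ {a b} {i : Fin a} {k : Fin b} → i ↑ˡ b ≢ a ↑ʳ k
↑ˡ≢↑ʳ {a} {b} {i} {k} eq
  with trans (sym (Fin.splitAt-↑ˡ a i b)) (trans (cong (splitAt a) eq) (Fin.splitAt-↑ʳ a b k))
... | ()

-- Splits part j of p according to p′: labels of p′ first, then the other labels of p.
refineAt : ∀ {n k k′} (p : Fin n → Fin (suc k)) (j : Fin (suc k)) (p′ : Fin n → Fin k′) → Fin n → Fin (k′ + k)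
refineAt {k = k} {k′} p j p′ v with p v Fin.≟ j
... | yes _   = p′ v ↑ˡ k
... | no pv≢j = k′ ↑ʳ punchOut (pv≢j ∘ sym)

module _ {n k k′} (p : Fin n → Fin (suc k)) {j : Fin (suc k)} (p′ : Fin n → Fin k′) where

  refineAt-inside : ∀ {v} → p v ≡ j → refineAt p j p′ v ≡ p′ v ↑ˡ k
  refineAt-inside {v} pv≡j with p v Fin.≟ j
  ... | yes _   = refl
  ... | no pv≢j = ⊥-elim (pv≢j pv≡j)

  refineAt-outside : ∀ {v} (pv≢j : p v ≢ j) → refineAt p j p′ v ≡ k′ ↑ʳ punchOut (pv≢j ∘ sym)
  refineAt-outside {v} pv≢j with p v Fin.≟ j
  ... | yes pv≡j = ⊥-elim (pv≢j pv≡j)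
  ... | no _     = cong (k′ ↑ʳ_) (Fin.punchOut-cong j refl)

  refineAt-≡ : ∀ {u v} → refineAt p j p′ u ≡ refineAt p j p′ v → p u ≡ p v
  refineAt-≡ {u} {v} eq = by-cases (p u Fin.≟ j) (p v Fin.≟ j)
    where
    by-cases : Dec (p u ≡ j) → Dec (p v ≡ j) → p u ≡ p v
    by-cases (yes pu≡j) (yes pv≡j) = trans pu≡j (sym pv≡j)
    by-cases (yes pu≡j) (no  pv≢j) =
      ⊥-elim (↑ˡ≢↑ʳ (trans (sym (refineAt-inside pu≡j)) (trans eq (refineAt-outside pv≢j))))
    by-cases (no  pu≢j) (yes pv≡j) =
      ⊥-elim (↑ˡ≢↑ʳ (trans (sym (refineAt-inside pv≡j)) (trans (sym eq) (refineAt-outside pu≢j))))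
    by-cases (no  pu≢j) (no  pv≢j) = Fin.punchOut-injective (pu≢j ∘ sym) (pv≢j ∘ sym)
      (Fin.↑ʳ-injective k′ _ _ (trans (sym (refineAt-outside pu≢j)) (trans eq (refineAt-outside pv≢j))))

  refineAt-≡-inside : ∀ {u v} → p u ≡ j → p v ≡ j → refineAt p j p′ u ≡ refineAt p j p′ v ⇔ p′ u ≡ p′ v
  refineAt-≡-inside pu≡j pv≡j rewrite refineAt-inside pu≡j | refineAt-inside pv≡j =
    mk⇔ (Fin.↑ˡ-injective k _ _) (cong (_↑ˡ k))

  refineAt-≡-outside : ∀ {u v} → p u ≡ p v → p u ≢ j → refineAt p j p′ u ≡ refineAt p j p′ v
  refineAt-≡-outside pu≡pv pu≢j =
    trans (refineAt-outside pu≢j)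
          (trans (cong (k′ ↑ʳ_) (Fin.punchOut-cong j pu≡pv)) (sym (refineAt-outside (pu≢j ∘ trans pu≡pv))))

refineAt-partition : ∀ {n k k′} {S : VSet n} {p : Fin n → Fin (suc k)} {j} {p′ : Fin n → Fin k′} →
  IsPartition S (suc k) p → IsPartition (part S p j) k′ p′ → IsPartition S (k′ + k) (refineAt p j p′)
refineAt-partition {k = k} {k′} {S} {p} {j} {p′} onto onto′ l with splitAt k′ l in eq
... | inj₁ i with onto′ i
...   | v , inPart , p′v≡i with part⇒ S p inPart
...     | Sv , pv≡j =
  v , Sv , trans (refineAt-inside p p′ pv≡j) (trans (cong (_↑ˡ k) p′v≡i) (Fin.splitAt⁻¹-↑ˡ eq))
refineAt-partition {k = k} {k′} {S} {p} {j} {p′} onto onto′ l | inj₂ i with onto (punchIn j i)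
...   | v , Sv , pv≡ji =
  v , Sv , trans (refineAt-outside p p′ pv≢j)
                 (trans (cong (k′ ↑ʳ_) (trans (Fin.punchOut-cong j pv≡ji) (Fin.punchOut-punchIn j)))
                        (Fin.splitAt⁻¹-↑ʳ eq))
  where
  pv≢j : p v ≢ j
  pv≢j pv≡j = Fin.punchInᵢ≢i j i (trans (sym pv≡ji) pv≡j)

mediant-≤ : ∀ a b c d → a ℕ.* (d + b) ≤ℕ (a + c) ℕ.* b → a ℕ.* d ≤ℕ c ℕ.* b
mediant-≤ a b c d le = ℕ.+-cancelʳ-≤ (a ℕ.* b) (a ℕ.* d) (c ℕ.* b)
  (subst₂ _≤ℕ_ (ℕ.*-distribˡ-+ a d b) (trans (ℕ.*-distribʳ-+ b a c) (ℕ.+-comm (a ℕ.* b) (c ℕ.* b))) le)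

module _ {n} (G : Graph n) where

  cross-pos : ∀ {S m} {p : Fin n → Fin (suc (suc m))} → Connected G S → IsPartition S (suc (suc m)) p →
              1 ≤ℕ cross G S p
  cross-pos {S} {p = p} conn onto with onto Fin.zero | onto (Fin.suc Fin.zero)
  ... | v₀ , Sv₀ , pv₀≡0 | v₁ , Sv₁ , pv₁≡1
    with Reach-crosses G p (conn v₀ v₁ Sv₀ Sv₁)
                           (λ pv₀≡pv₁ → Fin.0≢1+n (trans (sym pv₀≡0) (trans pv₀≡pv₁ pv₁≡1)))
  ... | a , b , e , (Sa , Sb) , pa≢pb = countEdges-pos G e (crossing Sa Sb pa≢pb) (crossing Sb Sa (pa≢pb ∘ sym))
    where
    crossing : ∀ {a b} → S a ≡ true → S b ≡ true → p a ≢ p b → (S a ∧ S b ∧ not (p a ≡ᵇ p b)) ≡ true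
    crossing Sa Sb pa≢pb = cong₂ _∧_ Sa (cong₂ _∧_ Sb (cong not (≢⇒≢ᵇ pa≢pb)))

  Φ-pos : ∀ {S φ} → Connected G S → IsPhi G S φ → 0ℚ < φ
  Φ-pos {S} conn ((m , p , onto , refl) , _) = frac-pos (cross-pos {p = p} conn onto)

  Φ-unique : ∀ {S φ φ′} → IsPhi G S φ → IsPhi G S φ′ → φ ≡ φ′
  Φ-unique ((m , p , onto , refl) , minimal) ((m′ , p′ , onto′ , refl) , minimal′) =
    ≤-antisym (minimal m′ p′ onto′) (minimal′ m p onto)

  cross-refineAt : ∀ {k k′} S (p : Fin n → Fin (suc k)) j (p′ : Fin n → Fin k′) →
                   cross G S (refineAt p j p′) ≡ cross G S p + cross G (part S p j) p′
  cross-refineAt {k} {k′} S p j p′ = begin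
    cross G S r
      ≡⟨ edgesIn-parts G S r≢ p ⟩
    edgesIn G S (λ u v → not (p u ≡ᵇ p v) ∧ r≢ u v) + sum (λ i → edgesIn G (part S p i) r≢)
      ≡⟨ cong₂ _+_ (edgesIn-cong G across) (sum-single _ j (λ i i≢j → edgesIn-none G (within-other i≢j))) ⟩
    cross G S p + edgesIn G (part S p j) r≢
      ≡⟨ cong (_+_ _) (edgesIn-cong G within) ⟩
    cross G S p + cross G (part S p j) p′
      ∎
    where
    open ≡-Reasoning
    r : Fin n → Fin (k′ + k)
    r = refineAt p j p′
    r≢ : Fin n → Fin n → Bool
    r≢ u v = not (r u ≡ᵇ r v)

    across : ∀ u v → adj G u v ≡ true → S u ≡ true → S v ≡ true → (not (p u ≡ᵇ p v) ∧ r≢ u v) ≡ not (p u ≡ᵇ p v)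
    across u v _ _ _ = ∧-true-on (λ pu≢ᵇpv → cong not (≢⇒≢ᵇ (≢ᵇ⇒≢ pu≢ᵇpv ∘ refineAt-≡ p p′)))

    within-other : ∀ {i} → i ≢ j → ∀ u v → adj G u v ≡ true →
                   part S p i u ≡ true → part S p i v ≡ true → r≢ u v ≡ false
    within-other i≢j u v _ inPart-u inPart-v with part⇒ S p inPart-u | part⇒ S p inPart-v
    ... | _ , pu≡i | _ , pv≡i =
      cong not (≡⇒≡ᵇ (refineAt-≡-outside p p′ (trans pu≡i (sym pv≡i)) (i≢j ∘ trans (sym pu≡i))))

    within : ∀ u v → adj G u v ≡ true → part S p j u ≡ true → part S p j v ≡ true →
             r≢ u v ≡ not (p′ u ≡ᵇ p′ v)
    within u v _ inPart-u inPart-v =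
      cong not (≡ᵇ-cong (refineAt-≡-inside p p′ (proj₂ (part⇒ S p inPart-u)) (proj₂ (part⇒ S p inPart-v))))

  -- Refining P* at part j by a partition of that part is a partition of S, so minimality of
  -- φ = c/(m+1) against (c + c′)/((m+1) + (m′+1)) is a mediant inequality giving φ ≤ c′/(m′+1).
  Φ-part-≥ : ∀ {S φ φ′ m} {p : Fin n → Fin (suc (suc m))} {j} →
             IsPhi G S φ → IsPartition S (suc (suc m)) p → ratio G S m p ≡ φ →
             IsPhi G (part S p j) φ′ → φ ≤ φ′
  Φ-part-≥ {S} {m = m} {p} {j} (_ , minimal) onto refl ((m′ , p′ , onto′ , refl) , _) =
    frac-mono-≤ {c} {m} {c′} {m′} (mediant-≤ c (suc m) c′ (suc m′) refined)
    where
    c c′ : ℕ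
    c  = cross G S p
    c′ = cross G (part S p j) p′
    refined : c ℕ.* (suc m′ + suc m) ≤ℕ (c + c′) ℕ.* suc m
    refined = subst (λ x → c ℕ.* (suc m′ + suc m) ≤ℕ x ℕ.* suc m) (cross-refineAt S p j p′)
      (frac-cancel-≤ c m (cross G S (refineAt p j p′)) (m′ + suc m)
        (minimal (m′ + suc m) (refineAt p j p′) (refineAt-partition onto onto′)))

-- The ideal-load recursion

module _ {n} {G : Graph n} where

  AllNodes-map : ∀ {P Q : VSet n → ℚ → Set} → (∀ {S φ} → P S φ → Q S φ) →
                 ∀ {S} (T : LoadTree G S) → AllNodes P T → AllNodes Q T
  AllNodes-map f (leaf _)                 _               = tt
  AllNodes-map f (node _ _ _ _ _ _ _ ts) (atRoot , below) = f atRoot , λ j → AllNodes-map f (ts j) (below j)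

  nodes-pos : ∀ {S} (T : LoadTree G S) → Connected G S → AllNodes (λ _ φ → 0ℚ < φ) T
  nodes-pos (leaf _)                        _     = tt
  nodes-pos (node φ isΦ m p onto r conn ts) connS = Φ-pos G connS isΦ , λ j → nodes-pos (ts j) (conn j)

  levels-≤ : ∀ {S x} (T : LoadTree G S) → Connected G S → (∀ {φ} → IsPhi G S φ → recip φ ≤ x) →
             AllNodes (λ _ φ → recip φ ≤ x) T
  levels-≤ (leaf _)                        _     _      = tt
  levels-≤ (node φ isΦ m p onto r conn ts) connS atRoot =
    atRoot isΦ , λ j → levels-≤ (ts j) (conn j) (λ isΦ′ → ≤-trans (below isΦ′) (atRoot isΦ))
    where
    below : ∀ {j φ′} → IsPhi G (part _ p j) φ′ → recip φ′ ≤ recip φ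
    below {j} isΦ′ = recip-antimono-≤ (Φ-pos G connS isΦ) (Φ-pos G (conn j) isΦ′) (Φ-part-≥ G isΦ onto r isΦ′)

  levels-≤-Φ : ∀ {S φ} (T : LoadTree G S) → Connected G S → IsPhi G S φ →
               AllNodes (λ _ φ′ → recip φ′ ≤ recip φ) T
  levels-≤-Φ T conn isΦ = levels-≤ T conn (λ isΦ′ → ≤-reflexive (cong recip (Φ-unique G isΦ′ isΦ)))

  -- Stated for the unfolded value of load at a node, so that p and ts determine it.
  load-inside : ∀ {k S} (p : Fin n → Fin k) (ts : (j : Fin k) → LoadTree G (part S p j)) {x j u v} →
                p u ≡ j → p v ≡ j → (if p u ≡ᵇ p v then load (ts (p u)) u v else x) ≡ load (ts j) u v
  load-inside p ts refl pv≡pu rewrite ≡⇒≡ᵇ (sym pv≡pu) = refl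

  load-across : ∀ {k S} (p : Fin n → Fin k) (ts : (j : Fin k) → LoadTree G (part S p j)) {x u v} →
                p u ≢ p v → (if p u ≡ᵇ p v then load (ts (p u)) u v else x) ≡ x
  load-across p ts pu≢pv rewrite ≢⇒≢ᵇ pu≢pv = refl

  Agrees : (Fin n → Fin n → ℚ) → ∀ {S} → LoadTree G S → Set
  Agrees ld {S} T = ∀ {u v} → S u ≡ true → S v ≡ true → ld u v ≡ load T u v

  Agrees-part : ∀ {ld k S x} (p : Fin n → Fin k) (ts : (j : Fin k) → LoadTree G (part S p j)) →
                (∀ {u v} → S u ≡ true → S v ≡ true → ld u v ≡ (if p u ≡ᵇ p v then load (ts (p u)) u v else x)) →
                ∀ j → Agrees ld (ts j)
  Agrees-part {S = S} p ts agree j inPart-u inPart-v =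
    trans (agree (proj₁ (part⇒ S p inPart-u)) (proj₁ (part⇒ S p inPart-v)))
          (load-inside p ts (proj₂ (part⇒ S p inPart-u)) (proj₂ (part⇒ S p inPart-v)))

  load-sym : ∀ {S} (T : LoadTree G S) u v → load T u v ≡ load T v u
  load-sym (leaf _) u v = refl
  load-sym T@(node φ isΦ m p onto r conn ts) u v = by-cases (p u Fin.≟ p v)
    where
    by-cases : Dec (p u ≡ p v) → load T u v ≡ load T v u
    by-cases (yes pu≡pv) = trans (load-inside p ts refl (sym pu≡pv))
                             (trans (load-sym (ts (p u)) u v) (sym (load-inside p ts (sym pu≡pv) refl)))
    by-cases (no  pu≢pv) = trans (load-across p ts pu≢pv) (sym (load-across p ts (pu≢pv ∘ sym)))

  load-AllNodes : ∀ {R : ℚ → Set} {S} (T : LoadTree G S) → AllNodes (λ _ φ → R (recip φ)) T →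
                  ∀ {u v} → adj G u v ≡ true → S u ≡ true → S v ≡ true → R (load T u v)
  load-AllNodes (leaf single) _ e Su Sv = ⊥-elim (adj⇒≢ G e (single _ _ Su Sv))
  load-AllNodes {R} {S} T@(node φ isΦ m p onto r conn ts) (atRoot , below) {u} {v} e Su Sv =
    by-cases (p u Fin.≟ p v)
    where
    by-cases : Dec (p u ≡ p v) → R (load T u v)
    by-cases (yes pu≡pv) = subst R (sym (load-inside p ts refl (sym pu≡pv)))
      (load-AllNodes {R} (ts (p u)) (below (p u)) e (⇒part S p Su refl) (⇒part S p Sv (sym pu≡pv)))
    by-cases (no  pu≢pv) = subst R (sym (load-across p ts pu≢pv)) atRoot

  load-pos : ∀ {S} (T : LoadTree G S) → Connected G S →
             ∀ {u v} → adj G u v ≡ true → S u ≡ true → S v ≡ true → 0ℚ < load T u v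
  load-pos T conn = load-AllNodes {R = 0ℚ <_} T (AllNodes-map recip-pos T (nodes-pos T conn))

-- Counting components level by level

pieces : ∀ {n} {G : Graph n} {B : ℚ → Set} → Decidable B → ∀ {S} → LoadTree G S → ℕ
pieces B? (leaf _)                 = 1
pieces B? (node φ _ _ _ _ _ _ ts) = if ⌊ B? (recip φ) ⌋ then sum (λ j → pieces B? (ts j)) else 1

module _ {n} {G : Graph n} {B : ℚ → Set} (B? : Decidable B) where

  pieces-one : ∀ {S} (T : LoadTree G S) → AllNodes (λ _ φ → ¬ B (recip φ)) T → pieces B? T ≡ 1
  pieces-one (leaf _) _ = refl
  pieces-one (node φ _ _ _ _ _ _ _) (¬Bφ , _) = if-false (⌊no⌋ (B? (recip φ)) ¬Bφ)

module Components {n} {G : Graph n} (ld : Fin n → Fin n → ℚ)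
                  {B : ℚ → Set} (B? : Decidable B) (B-up : ∀ {x y} → x ≤ y → B x → B y)
                  {k} {c : Fin n → Fin k} (comps : IsComponents G (λ a b → B (ld a b)) k c) where

  Light : Fin n → Fin n → Set
  Light a b = ¬ B (ld a b)

  rep : Fin k → Fin n
  rep i = proj₁ (proj₁ comps i)

  c-rep : ∀ i → c (rep i) ≡ i
  c-rep i = proj₂ (proj₁ comps i)

  Closed : VSet n → Set
  Closed S = ∀ {u v} → adj G u v ≡ true → Light u v → S u ≡ true → S v ≡ true

  Reach-closed : ∀ {S} → Closed S → ∀ {u v} → Reach G Light u v → S u ≡ true → S v ≡ true
  Reach-closed closed here          Su = Su
  Reach-closed closed (step e ok r) Su = Reach-closed closed r (closed e ok Su)

  -- A component is counted through its representative; a closed S is a union of components.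
  meets-one : ∀ {S s} → Connected G S → Closed S → S s ≡ true →
              (∀ {u v} → adj G u v ≡ true → S u ≡ true → S v ≡ true → Light u v) →
              sum (λ i → b2n (S (rep i))) ≡ 1
  meets-one {S} {s} conn closed Ss light = trans (sum-single _ (c s) elsewhere) here′
    where
    elsewhere : ∀ i → i ≢ c s → b2n (S (rep i)) ≡ 0
    elsewhere i i≢cs with S (rep i) in Srep
    ... | false = refl
    ... | true  = ⊥-elim (i≢cs (trans (sym (c-rep i))
                    (proj₂ (proj₂ comps) _ _ (Reach-map G (λ e (Su , Sv) → light e Su Sv) (conn _ _ Srep Ss)))))
    here′ : b2n (S (rep (c s))) ≡ 1
    here′ rewrite Reach-closed closed (proj₁ (proj₂ comps) s (rep (c s)) (sym (c-rep (c s)))) Ss = refl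

  meets-pieces : ∀ {S} (T : LoadTree G S) → Connected G S → (∃ λ s → S s ≡ true) → Agrees ld T → Closed S →
                 sum (λ i → b2n (S (rep i))) ≡ pieces B? T
  meets-pieces (leaf single) conn (s , Ss) agree closed =
    meets-one conn closed Ss (λ e Su Sv → ⊥-elim (adj⇒≢ G e (single _ _ Su Sv)))
  meets-pieces {S} T@(node φ isΦ m p onto r conn ts) connS (s , Ss) agree closed = by-cases (B? (recip φ))
    where
    open ≡-Reasoning

    light : ¬ B (recip φ) → ∀ {u v} → adj G u v ≡ true → S u ≡ true → S v ≡ true → Light u v
    light ¬Bφ e Su Sv = subst (¬_ ∘ B) (sym (agree Su Sv)) (load-AllNodes {R = ¬_ ∘ B} T lights e Su Sv)
      where
      lights : AllNodes (λ _ φ′ → ¬ B (recip φ′)) T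
      lights = AllNodes-map (λ ≤φ Bx → ¬Bφ (B-up ≤φ Bx)) T (levels-≤-Φ T connS isΦ)

    closed-part : B (recip φ) → ∀ j → Closed (part S p j)
    closed-part Bφ j {u} {v} e light inPart-u = by-label (p v Fin.≟ j)
      where
      Su = proj₁ (part⇒ S p inPart-u)
      Sv = closed e light Su
      by-label : Dec (p v ≡ j) → part S p j v ≡ true
      by-label (yes pv≡j) = ⇒part S p Sv pv≡j
      by-label (no  pv≢j) = ⊥-elim (light (subst B (sym (trans (agree Su Sv) (load-across p ts pu≢pv))) Bφ))
        where
        pu≢pv : p u ≢ p v
        pu≢pv pu≡pv = pv≢j (trans (sym pu≡pv) (proj₂ (part⇒ S p inPart-u)))

    by-cases : Dec (B (recip φ)) → sum (λ i → b2n (S (rep i))) ≡ pieces B? T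
    by-cases (no ¬Bφ) = trans (meets-one connS closed Ss (light ¬Bφ)) (sym (if-false (⌊no⌋ (B? (recip φ)) ¬Bφ)))
    by-cases (yes Bφ) = begin
      sum (λ i → b2n (S (rep i)))                        ≡⟨ sum-cong-≗ (b2n-parts S p ∘ rep) ⟩
      sum (λ i → sum (λ j → b2n (part S p j (rep i))))  ≡⟨ ∑-comm (λ i j → b2n (part S p j (rep i))) ⟩
      sum (λ j → sum (λ i → b2n (part S p j (rep i))))
        ≡⟨ sum-cong-≗ (λ j → meets-pieces (ts j) (conn j) (part-nonempty S p onto j)
                                           (Agrees-part p ts agree j) (closed-part Bφ j)) ⟩
      sum (λ j → pieces B? (ts j))                       ≡⟨ sym (if-true (⌊yes⌋ (B? (recip φ)) Bφ)) ⟩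
      pieces B? T                                        ∎

  count : (T : LoadTree G allV) → Connected G allV → Agrees ld T → Fin n → k ≡ pieces B? T
  count T conn agree s = trans (sym (sum-ones k)) (meets-pieces T conn (s , refl) agree (λ _ _ _ → refl))

module _ {n} {G : Graph n} where

  -- A node with suc (suc m) parts contributes κ(P*) − 1 = suc m.
  newParts : ℚ → ∀ {S} → LoadTree G S → ℕ
  newParts ℓ (leaf _)                 = 0
  newParts ℓ (node φ _ m _ _ _ _ ts) = (if ⌊ recip φ ≟ ℓ ⌋ then suc m else 0) + sum (λ j → newParts ℓ (ts j))

  newParts-zero : ∀ {ℓ S} (T : LoadTree G S) → AllNodes (λ _ φ → recip φ < ℓ) T → newParts ℓ T ≡ 0
  newParts-zero {ℓ} (leaf _) _ = refl
  newParts-zero {ℓ} (node φ _ _ _ _ _ _ ts) (φ<ℓ , below) =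
    cong₂ _+_ (if-false (⌊no⌋ (recip φ ≟ ℓ) (λ φ≡ℓ → <-irrefl φ≡ℓ φ<ℓ)))
              (sum-zero (λ j → newParts-zero (ts j) (below j)))

  pieces-step : ∀ ℓ {S} (T : LoadTree G S) → Connected G S →
                pieces (ℓ ≤?_) T ≡ pieces (ℓ <?_) T + newParts ℓ T
  pieces-step ℓ (leaf _) _ = refl
  pieces-step ℓ T@(node φ isΦ m p onto r conn ts) connS = by-cases (<-cmp ℓ (recip φ))
    where
    open ≡-Reasoning
    Σ≤ Σ< Σnew : ℕ
    Σ≤   = sum (λ j → pieces (ℓ ≤?_) (ts j))
    Σ<   = sum (λ j → pieces (ℓ <?_) (ts j))
    Σnew = sum (λ j → newParts ℓ (ts j))

    ≤-splits : ℓ ≤ recip φ → pieces (ℓ ≤?_) T ≡ Σ≤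
    ≤-splits = if-true ∘ ⌊yes⌋ (ℓ ≤? recip φ)
    ≤-whole : ¬ ℓ ≤ recip φ → pieces (ℓ ≤?_) T ≡ 1
    ≤-whole = if-false ∘ ⌊no⌋ (ℓ ≤? recip φ)
    <-splits : ℓ < recip φ → pieces (ℓ <?_) T ≡ Σ<
    <-splits = if-true ∘ ⌊yes⌋ (ℓ <? recip φ)
    <-whole : ¬ ℓ < recip φ → pieces (ℓ <?_) T ≡ 1
    <-whole = if-false ∘ ⌊no⌋ (ℓ <? recip φ)
    at-level : recip φ ≡ ℓ → newParts ℓ T ≡ suc m + Σnew
    at-level = cong (_+ Σnew) ∘ if-true ∘ ⌊yes⌋ (recip φ ≟ ℓ)
    off-level : recip φ ≢ ℓ → newParts ℓ T ≡ Σnew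
    off-level = cong (_+ Σnew) ∘ if-false ∘ ⌊no⌋ (recip φ ≟ ℓ)

    levels : AllNodes (λ _ φ′ → recip φ′ ≤ recip φ) T
    levels = levels-≤-Φ T connS isΦ

    children : Σ≤ ≡ Σ< + Σnew
    children = trans (sum-cong-≗ (λ j → pieces-step ℓ (ts j) (conn j)))
                     (∑-distrib-+ (λ j → pieces (ℓ <?_) (ts j)) (λ j → newParts ℓ (ts j)))

    by-cases : Tri (ℓ < recip φ) (ℓ ≡ recip φ) (recip φ < ℓ) →
               pieces (ℓ ≤?_) T ≡ pieces (ℓ <?_) T + newParts ℓ T
    by-cases (tri< ℓ<φ ℓ≢φ _) = begin
      pieces (ℓ ≤?_) T                 ≡⟨ ≤-splits (<⇒≤ ℓ<φ) ⟩
      Σ≤                               ≡⟨ children ⟩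
      Σ< + Σnew                        ≡⟨ cong₂ _+_ (sym (<-splits ℓ<φ)) (sym (off-level (ℓ≢φ ∘ sym))) ⟩
      pieces (ℓ <?_) T + newParts ℓ T  ∎
    by-cases (tri≈ _ ℓ≡φ _) = begin
      pieces (ℓ ≤?_) T                 ≡⟨ ≤-splits (≤-reflexive ℓ≡φ) ⟩
      Σ≤                               ≡⟨ children ⟩
      Σ< + Σnew                        ≡⟨ cong (_+ Σnew) (trans (sum-cong-≗ child-whole) (sum-ones (suc (suc m)))) ⟩
      1 + (suc m + Σnew)               ≡⟨ cong₂ _+_ (sym (<-whole (<-irrefl ℓ≡φ))) (sym (at-level (sym ℓ≡φ))) ⟩
      pieces (ℓ <?_) T + newParts ℓ T  ∎
      where
      child-whole : ∀ j → pieces (ℓ <?_) (ts j) ≡ 1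
      child-whole j = pieces-one (ℓ <?_) (ts j) (AllNodes-map ≤φ⇒≯ℓ (ts j) (proj₂ levels j))
        where
        ≤φ⇒≯ℓ : ∀ {x} → x ≤ recip φ → ¬ ℓ < x
        ≤φ⇒≯ℓ x≤φ ℓ<x = <-irrefl ℓ≡φ (<-≤-trans ℓ<x x≤φ)
    by-cases (tri> _ _ φ<ℓ) = begin
      pieces (ℓ ≤?_) T                 ≡⟨ ≤-whole (<-irrefl refl ∘ <-≤-trans φ<ℓ) ⟩
      1 + 0                            ≡⟨ cong₂ _+_ (sym (<-whole (<-asym φ<ℓ))) (sym (newParts-zero T below)) ⟩
      pieces (ℓ <?_) T + newParts ℓ T  ∎
      where
      below : AllNodes (λ _ φ′ → recip φ′ < ℓ) T
      below = AllNodes-map (λ ≤φ → ≤-<-trans ≤φ φ<ℓ) T levels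

  -- c/(d+1) is one representation of 1/ℓ, which equals Φ at every node of level ℓ.
  edges-at-level : ∀ ℓ {c d} → recip ℓ ≡ frac c d → (ld : Fin n → Fin n → ℚ) →
                   ∀ {S} (T : LoadTree G S) → Connected G S → Agrees ld T →
                   edgesIn G S (λ u v → ⌊ ld u v ≟ ℓ ⌋) ℕ.* suc d ≡ newParts ℓ T ℕ.* c
  edges-at-level ℓ {c} {d} ℓ⁻¹≡ ld (leaf single) _ _ =
    cong (ℕ._* suc d) (edgesIn-none G (λ u v e Su Sv → ⊥-elim (adj⇒≢ G e (single u v Su Sv))))
  edges-at-level ℓ {c} {d} ℓ⁻¹≡ ld {S} (node φ isΦ m p onto r conn ts) connS agree = begin
    edgesIn G S atℓ ℕ.* suc d                        ≡⟨ cong (ℕ._* suc d) (edgesIn-parts G S atℓ p) ⟩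
    (crossing + sum inPart) ℕ.* suc d                ≡⟨ ℕ.*-distribʳ-+ (suc d) crossing (sum inPart) ⟩
    crossing ℕ.* suc d + sum inPart ℕ.* suc d        ≡⟨ cong (_+_ _) (*-distribʳ-sum (suc d) inPart) ⟩
    crossing ℕ.* suc d + sum (λ j → inPart j ℕ.* suc d)
      ≡⟨ cong₂ _+_ crossing-count (sum-cong-≗ inside) ⟩
    atRoot ℕ.* c + sum (λ j → newParts ℓ (ts j) ℕ.* c) ≡⟨ cong (_+_ _) (sym (*-distribʳ-sum c new)) ⟩
    atRoot ℕ.* c + sum new ℕ.* c                     ≡⟨ sym (ℕ.*-distribʳ-+ c atRoot (sum new)) ⟩
    (atRoot + sum new) ℕ.* c                         ∎
    where
    open ≡-Reasoning
    atℓ : Fin n → Fin n → Bool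
    atℓ u v = ⌊ ld u v ≟ ℓ ⌋
    crossing atRoot : ℕ
    crossing = edgesIn G S (λ u v → not (p u ≡ᵇ p v) ∧ atℓ u v)
    atRoot   = if ⌊ recip φ ≟ ℓ ⌋ then suc m else 0
    inPart new : Fin (suc (suc m)) → ℕ
    inPart j = edgesIn G (part S p j) atℓ
    new j    = newParts ℓ (ts j)

    inside : ∀ j → edgesIn G (part S p j) atℓ ℕ.* suc d ≡ newParts ℓ (ts j) ℕ.* c
    inside j = edges-at-level ℓ ℓ⁻¹≡ ld (ts j) (conn j) (Agrees-part p ts agree j)

    crossing-load : ∀ {u v} → S u ≡ true → S v ≡ true → not (p u ≡ᵇ p v) ≡ true → atℓ u v ≡ ⌊ recip φ ≟ ℓ ⌋
    crossing-load Su Sv pu≢ᵇpv = cong (λ x → ⌊ x ≟ ℓ ⌋) (trans (agree Su Sv) (load-across p ts (≢ᵇ⇒≢ pu≢ᵇpv)))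

    crossing-count : crossing ℕ.* suc d ≡ atRoot ℕ.* c
    crossing-count = by-cases (recip φ ≟ ℓ)
      where
      by-cases : Dec (recip φ ≡ ℓ) → crossing ℕ.* suc d ≡ atRoot ℕ.* c
      by-cases (no φ≢ℓ) = begin
        crossing ℕ.* suc d  ≡⟨ cong (ℕ._* suc d) (edgesIn-none G (λ u v _ Su Sv →
                                  ∧-false-on (λ h → trans (crossing-load Su Sv h) (⌊no⌋ (recip φ ≟ ℓ) φ≢ℓ)))) ⟩
        0                   ≡⟨ cong (ℕ._* c) (sym (if-false (⌊no⌋ (recip φ ≟ ℓ) φ≢ℓ))) ⟩
        atRoot ℕ.* c        ∎
      by-cases (yes φ≡ℓ) = begin
        crossing ℕ.* suc d      ≡⟨ cong (ℕ._* suc d) (edgesIn-cong G (λ u v _ Su Sv → ∧-true-on λ h →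
                                     trans (crossing-load Su Sv h) (⌊yes⌋ (recip φ ≟ ℓ) φ≡ℓ))) ⟩
        cross G S p ℕ.* suc d   ≡⟨ frac-injective (cross G S p) m c d (trans r φ≡c/d) ⟩
        c ℕ.* suc m             ≡⟨ ℕ.*-comm c (suc m) ⟩
        suc m ℕ.* c             ≡⟨ cong (ℕ._* c) (sym (if-true (⌊yes⌋ (recip φ ≟ ℓ) φ≡ℓ))) ⟩
        atRoot ℕ.* c            ∎
        where
        φ≡c/d : φ ≡ frac c d
        φ≡c/d = trans (sym (recip-involutive (Φ-pos G connS isΦ))) (trans (cong recip φ≡ℓ) ℓ⁻¹≡)

-- Plateaus

module _ {t} {L : Fin t → ℚ} (L-decr : ∀ q r → q <F r → L r < L q) where

  earlier⇔> : ∀ {q x} → (∃ λ s → x ≡ L s) → (∃ λ r → r <F q × x ≡ L r) ⇔ L q < x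
  earlier⇔> {q} {x} (s , x≡Ls) = mk⇔ (λ (r , r<q , x≡Lr) → subst (L q <_) (sym x≡Lr) (L-decr r q r<q)) from
    where
    from : L q < x → ∃ λ r → r <F q × x ≡ L r
    from Lq<x with Fin.<-cmp s q
    ... | tri< s<q _ _ = s , s<q , x≡Ls
    ... | tri≈ _ s≡q _ = ⊥-elim (<-irrefl (trans (cong L (sym s≡q)) (sym x≡Ls)) Lq<x)
    ... | tri> _ _ q<s = ⊥-elim (<-asym Lq<x (subst (_< L q) (sym x≡Ls) (L-decr q s q<s)))

  earlier-or-now⇔≥ : ∀ {q x} → (∃ λ s → x ≡ L s) → (∃ λ r → r ≤F q × x ≡ L r) ⇔ L q ≤ x
  earlier-or-now⇔≥ {q} {x} (s , x≡Ls) = mk⇔ to from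
    where
    to : (∃ λ r → r ≤F q × x ≡ L r) → L q ≤ x
    to (r , r≤q , x≡Lr) with ℕ.m≤n⇒m<n∨m≡n r≤q
    ... | inj₁ r<q = subst (L q ≤_) (sym x≡Lr) (<⇒≤ (L-decr r q r<q))
    ... | inj₂ r≡q = ≤-reflexive (trans (cong L (sym (Fin.toℕ-injective r≡q))) (sym x≡Lr))
    from : L q ≤ x → ∃ λ r → r ≤F q × x ≡ L r
    from Lq≤x with Fin.<-cmp s q
    ... | tri< s<q _ _ = s , ℕ.<⇒≤ s<q , x≡Ls
    ... | tri≈ _ s≡q _ = s , ℕ.≤-reflexive (cong toℕ s≡q) , x≡Ls
    ... | tri> _ _ q<s = ⊥-elim (<-irrefl refl (<-≤-trans (L-decr q s q<s) (subst (L q ≤_) x≡Ls Lq≤x)))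

plateau : ∀ {n} (G : Graph n) → Connected G allV → (T : LoadTree G allV) → ∀ {ℓ} → 0ℚ < ℓ →
          ∀ {u₀ v₀} → adj G u₀ v₀ ≡ true → load T u₀ v₀ ≡ ℓ →
          ∀ {k₀ c₀ k₁ c₁} →
          IsComponents G (λ a b → ℓ < load T a b) k₀ c₀ → IsComponents G (λ a b → ℓ ≤ load T a b) k₁ c₁ →
          k₀ <ℕ k₁ × frac (countEdges G (λ u v → ⌊ load T u v ≟ ℓ ⌋)) 0 ≡ frac (k₁ ∸ k₀) 0 * recip ℓ
plateau G conn T {ℓ} ℓ>0 {u₀} {v₀} e₀ atℓ {k₀} {c₀} {k₁} {c₁} comps₀ comps₁ =
  subst (k₀ <ℕ_) (sym k₁≡) (ℕ.m<m+n k₀ new>0) ,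
  trans (frac-scale E N c d edges-count)
        (cong₂ _*_ (cong (λ k → frac k 0) (sym k₁∸k₀≡)) (sym ℓ⁻¹≡c/d))
  where
  E N : ℕ
  E = countEdges G (λ u v → ⌊ load T u v ≟ ℓ ⌋)
  N = newParts ℓ T

  k₁≡ : k₁ ≡ k₀ + N
  k₁≡ = trans (Components.count (load T) (ℓ ≤?_) (λ x≤y ℓ≤x → ≤-trans ℓ≤x x≤y) comps₁ T conn (λ _ _ → refl) u₀)
       (trans (pieces-step ℓ T conn)
              (cong (_+ N) (sym (Components.count (load T) (ℓ <?_) (λ x≤y ℓ<x → <-≤-trans ℓ<x x≤y)
                                                               comps₀ T conn (λ _ _ → refl) u₀))))

  k₁∸k₀≡ : k₁ ∸ k₀ ≡ N
  k₁∸k₀≡ = trans (cong (_∸ k₀) k₁≡) (ℕ.m+n∸m≡n k₀ N)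

  c d : ℕ
  c = proj₁ (pos⇒frac (recip-pos ℓ>0))
  d = proj₁ (proj₂ (pos⇒frac (recip-pos ℓ>0)))
  ℓ⁻¹≡c/d : recip ℓ ≡ frac c d
  ℓ⁻¹≡c/d = proj₂ (proj₂ (pos⇒frac (recip-pos ℓ>0)))

  edges-count : E ℕ.* suc d ≡ N ℕ.* c
  edges-count = edges-at-level ℓ ℓ⁻¹≡c/d (load T) T conn (λ _ _ → refl)

  E>0 : 1 ≤ℕ E
  E>0 = countEdges-pos G e₀ (⌊yes⌋ (load T u₀ v₀ ≟ ℓ) atℓ)
                            (⌊yes⌋ (load T v₀ u₀ ≟ ℓ) (trans (load-sym T v₀ u₀) atℓ))

  new>0 : 0 <ℕ N
  new>0 = ℕ.n≢0⇒n>0 λ N≡0 → ℕ.<⇒≢ E>0 (sym (ℕ.m*n≡0⇒m≡0 E (suc d) (trans edges-count (cong (ℕ._* c) N≡0))))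

theorem3p1 :
  ∀ {n} (G : Graph n) → Connected G allV →
  (T : LoadTree G allV) →
  (t : ℕ) (L : Fin t → ℚ) →
  (∀ q r → q <F r → L r < L q) →
  (∀ u v → adj G u v ≡ true → ∃ λ q → load T u v ≡ L q) →
  (∀ q → ∃ λ u → ∃ λ v → adj G u v ≡ true × load T u v ≡ L q) →
  (∀ q → 0ℚ < recip (L q))
  × (∀ q r → q <F r → recip (L q) < recip (L r))
  × (∀ q (k₀ : ℕ) (p₀ : Fin n → Fin k₀) (k₁ : ℕ) (p₁ : Fin n → Fin k₁) →
      IsComponents G (λ u v → ∃ λ r → r <F q × load T u v ≡ L r) k₀ p₀ →
      IsComponents G (λ u v → ∃ λ r → r ≤F q × load T u v ≡ L r) k₁ p₁ →
      (∀ u v → p₁ u ≡ p₁ v → p₀ u ≡ p₀ v)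
      × k₀ <ℕ k₁
      × (∀ u v → adj G u v ≡ true → load T u v ≡ L q → p₀ u ≡ p₀ v)
      × ((+ countEdges G (λ u v → ⌊ load T u v ≟ L q ⌋)) / 1
          ≡ ((+ (k₁ ∸ k₀)) / 1) * recip (L q)))
  × (∀ q → AllNodes (λ S φ → recip φ ≡ L q → φ ≡ recip (L q)) T)
theorem3p1 G conn T t L L-decr load∈L attained =
    (λ q → recip-pos (L-pos q))
  , (λ q r q<r → recip-antimono-< (L-pos r) (L-pos q) (L-decr q r q<r))
  , (λ q k₀ p₀ k₁ p₁ comps₀ comps₁ →
      let (u , v , e , atL) = attained q
          (k₀<k₁ , count) = plateau G conn T (L-pos q) e atL
            (IsComponents-cong G (λ {a} {b} e → earlier⇔> L-decr (load∈L a b e)) comps₀)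
            (IsComponents-cong G (λ {a} {b} e → earlier-or-now⇔≥ L-decr (load∈L a b e)) comps₁)
      in IsComponents-refine G (λ (r , r<q , eq) → r , ℕ.<⇒≤ r<q , eq) comps₀ comps₁
       , k₀<k₁
       , (λ u v e atL′ → IsComponents-edge G comps₀ e
            (λ (r , r<q , eq) → <-irrefl (trans (sym atL′) eq) (L-decr r q r<q)))
       , count)
  , (λ q → AllNodes-map (λ φ>0 φ⁻¹≡ → trans (sym (recip-involutive φ>0)) (cong recip φ⁻¹≡))
                        T (nodes-pos T conn))
  where
  L-pos : ∀ q → 0ℚ < L q
  L-pos q = let (u , v , e , atL) = attained q in subst (0ℚ <_) atL (load-pos T conn e refl refl)
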